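{- There exist infinitely many cyclic $(n_3)$ configurations that are unsplittable.
   Context: A combinatorial $(n_3)$ configuration consists of $n$ points and $n$ lines with an incidence relation such that: - each line is incident with 3 points; - each point is incident with 3 lines; - two distinct points lie on at most one common line. Its Levi graph $L$ is the bipartite point–line incidence graph. The configuration is cyclic if it has an automorphism of order $n$ that cyclically permutes the points and cyclically permutes the lines. The square $L^2$ of $L$ joins two distinct vertices iff their distance in $L$ is at most 2. The configuration is splittable if there is a set $\Sigma$ of vertices of $L$ that is independent in $L^2$ and such that $L-\Sigma$ is disconnected. It is unsplittable otherwise. -}

module Defs where

open import Data.Nat using (ℕ; zero; suc; _+_)
open import Data.Fin using (Fin; zero; suc)
open import Data.Bool using (Bool; true; false; if_then_else_)
open import Data.Sum using (_⊎_; inj₁; inj₂)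
open import Data.Product using (Σ; ∃; _×_; _,_)
open import Data.Empty using (⊥)
open import Relation.Nullary using (¬_)
open import Relation.Binary.PropositionalEquality using (_≡_; _≢_)
open import Function.Definitions using (Bijective)

count : ∀ {n} → (Fin n → Bool) → ℕ
count {zero}  f = 0
count {suc n} f = (if f zero then 1 else 0) + count (λ i → f (suc i))

iter : ∀ {A : Set} → (A → A) → ℕ → A → A
iter f zero    x = x
iter f (suc k) x = f (iter f k x)

record Config (n : ℕ) : Set where
  field
    inc       : Fin n → Fin n → Bool
    line3     : ∀ (l : Fin n) → count (λ p → inc p l) ≡ 3
    point3    : ∀ (p : Fin n) → count (λ l → inc p l) ≡ 3
    atMostOne : ∀ (p q l m : Fin n) → p ≢ q →
                inc p l ≡ true → inc q l ≡ true →
                inc p m ≡ true → inc q m ≡ true → l ≡ m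
open Config public

-- Cyclic: an automorphism (σ on points, τ on lines, both bijections,
-- preserving incidence in both directions) such that σ permutes the n points
-- in a single cycle and τ permutes the n lines in a single cycle
-- (hence the automorphism has order n).
record Cyclic {n : ℕ} (C : Config n) : Set where
  field
    σ       : Fin n → Fin n
    τ       : Fin n → Fin n
    σ-bij   : Bijective _≡_ _≡_ σ
    τ-bij   : Bijective _≡_ _≡_ τ
    pres    : ∀ (p l : Fin n) → inc C (σ p) (τ l) ≡ inc C p l
    p₀      : Fin n
    l₀      : Fin n
    σ-cycle : ∀ (p : Fin n) → ∃ λ k → iter σ k p₀ ≡ p
    τ-cycle : ∀ (l : Fin n) → ∃ λ k → iter τ k l₀ ≡ l

-- Levi graph: vertices are points (inj₁) and lines (inj₂).
Vertex : ℕ → Set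
Vertex n = Fin n ⊎ Fin n

Adj : ∀ {n} → Config n → Vertex n → Vertex n → Set
Adj C (inj₁ p) (inj₁ q) = ⊥
Adj C (inj₁ p) (inj₂ l) = inc C p l ≡ true
Adj C (inj₂ l) (inj₁ p) = inc C p l ≡ true
Adj C (inj₂ l) (inj₂ m) = ⊥

Adj² : ∀ {n} → Config n → Vertex n → Vertex n → Set
Adj² C u v = u ≢ v × (Adj C u v ⊎ ∃ λ w → Adj C u w × Adj C w v)

-- walks in L − S (all vertices after the start avoid S)
data Reach {n : ℕ} (C : Config n) (S : Vertex n → Bool) : Vertex n → Vertex n → Set where
  here : ∀ {u} → Reach C S u u
  step : ∀ {u v w} → Adj C u v → S v ≡ false → Reach C S v w → Reach C S u w

Disconnected : ∀ {n} → Config n → (Vertex n → Bool) → Set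
Disconnected C S = ∃ λ u → ∃ λ v →
  S u ≡ false × S v ≡ false × ¬ Reach C S u v

IndependentInSquare : ∀ {n} → Config n → (Vertex n → Bool) → Set
IndependentInSquare C S = ∀ u v → S u ≡ true → S v ≡ true → ¬ Adj² C u v

Splittable : ∀ {n} → Config n → Set
Splittable C = ∃ λ (S : Vertex _ → Bool) → IndependentInSquare C S × Disconnected C S

Unsplittable : ∀ {n} → Config n → Set
Unsplittable C = ¬ Splittable C

-- For every n ≥ 7 take points and lines ℤ/n and let point p lie on line l
-- iff p − l ∈ D = {0, 1, 3}.  Since D is a Sidon set (all differences of
-- two of its elements are distinct, and they are all smaller than 7 ≤ n), two
-- lines share at most one point, so this is a cyclic (n₃) configuration; the
-- rotation x ↦ x + 1 of points and lines is the cyclic automorphism.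
--
-- Unsplittability: the Levi graph has the Hamiltonian cycle
--   P₀ L₀ P₁ L₁ … P_{n−1} L_{n−1}   (P_p on L_p as 0 ∈ D, P_{l+1} on L_l as 1 ∈ D).
-- If S is independent in L² and w ∉ S, w⁺ ∈ S are consecutive on the cycle,
-- a short explicit detour inside a window of seven consecutive labels leads
-- from w to w⁺⁺ avoiding S.  Walking around the cycle and bypassing every
-- vertex of S this way connects any two vertices outside S.
module Submission where

open import Defs
open import Data.Nat using (ℕ; zero; suc; _+_; _∸_; _≤_; _<_; z≤n; s≤s; NonZero; _<?_)
open import Data.Nat.Properties
  using (+-identityʳ; +-assoc; +-comm; +-suc; +-mono-≤; ≤-trans; m≤m+n; m≤n+m; <⇒≤; m∸n+n≡m; m+[n∸m]≡n)
  renaming (_≟_ to _≟ℕ_)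
open import Data.Nat.DivMod using (_%_; _mod_; %-distribˡ-+; m%n%n≡m%n; [m+n]%n≡m%n; m<n⇒m%n≡m)
open import Data.Fin using (Fin; zero; suc; toℕ)
open import Data.Fin.Properties using (toℕ-injective; suc-injective; toℕ<n; toℕ-fromℕ<; _≟_; any?; all?)
open import Data.Bool using (Bool; true; false; _∨_; if_then_else_)
open import Data.Sum using (inj₁; inj₂)
open import Data.Sum.Properties using (inj₁-injective; inj₂-injective)
open import Data.Product using (Σ; ∃; _×_; _,_; proj₁)
open import Data.Unit using (tt)
open import Data.Empty using (⊥-elim)
open import Relation.Nullary using (¬_; Dec; yes; no; does; contradiction)
open import Relation.Nullary.Decidable using (True; False; toWitness; toWitnessFalse; dec-true; dec-false; does-⇔; ¬?; _→-dec_)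
open import Relation.Binary.PropositionalEquality
open import Function.Definitions using (Injective; Bijective)
open import Function.Bundles using (mk⇔)

module Rotation (n : ℕ) .{{_ : NonZero n}} where
  open ≡-Reasoning

  shift : ℕ → Fin n → Fin n
  shift a x = (toℕ x + a) mod n

  toℕ-shift : ∀ a x → toℕ (shift a x) ≡ (toℕ x + a) % n
  toℕ-shift a x = toℕ-fromℕ< _

  shift-0 : ∀ x → shift 0 x ≡ x
  shift-0 x = toℕ-injective (begin
    toℕ (shift 0 x)   ≡⟨ toℕ-shift 0 x ⟩
    (toℕ x + 0) % n   ≡⟨ cong (_% n) (+-identityʳ (toℕ x)) ⟩
    toℕ x % n         ≡⟨ m<n⇒m%n≡m (toℕ<n x) ⟩
    toℕ x             ∎)

  shift-+ : ∀ a b x → shift a (shift b x) ≡ shift (a + b) x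
  shift-+ a b x = toℕ-injective (begin
    toℕ (shift a (shift b x))          ≡⟨ toℕ-shift a (shift b x) ⟩
    (toℕ (shift b x) + a) % n          ≡⟨ cong (λ z → (z + a) % n) (toℕ-shift b x) ⟩
    ((toℕ x + b) % n + a) % n          ≡⟨ %-distribˡ-+ ((toℕ x + b) % n) a n ⟩
    ((toℕ x + b) % n % n + a % n) % n  ≡⟨ cong (λ z → (z + a % n) % n) (m%n%n≡m%n (toℕ x + b) n) ⟩
    ((toℕ x + b) % n + a % n) % n      ≡⟨ %-distribˡ-+ (toℕ x + b) a n ⟨
    (toℕ x + b + a) % n                ≡⟨ cong (_% n) (trans (+-assoc (toℕ x) b a) (cong (toℕ x +_) (+-comm b a))) ⟩
    (toℕ x + (a + b)) % n              ≡⟨ toℕ-shift (a + b) x ⟨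
    toℕ (shift (a + b) x)              ∎)

  shift-comm : ∀ a b x → shift a (shift b x) ≡ shift b (shift a x)
  shift-comm a b x = begin
    shift a (shift b x)  ≡⟨ shift-+ a b x ⟩
    shift (a + b) x      ≡⟨ cong (λ c → shift c x) (+-comm a b) ⟩
    shift (b + a) x      ≡⟨ shift-+ b a x ⟨
    shift b (shift a x)  ∎

  shift-n : ∀ x → shift n x ≡ x
  shift-n x = toℕ-injective (trans (toℕ-shift n x) (trans ([m+n]%n≡m%n (toℕ x) n) (m<n⇒m%n≡m (toℕ<n x))))

  shift-inverseˡ : ∀ {a} x → a ≤ n → shift (n ∸ a) (shift a x) ≡ x
  shift-inverseˡ {a} x a≤n = trans (shift-+ (n ∸ a) a x) (trans (cong (λ c → shift c x) (m∸n+n≡m a≤n)) (shift-n x))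

  shift-inverseʳ : ∀ {a} x → a ≤ n → shift a (shift (n ∸ a) x) ≡ x
  shift-inverseʳ {a} x a≤n = trans (shift-+ a (n ∸ a) x) (trans (cong (λ c → shift c x) (m+[n∸m]≡n a≤n)) (shift-n x))

  shift-injective : ∀ {a x y} → a ≤ n → shift a x ≡ shift a y → x ≡ y
  shift-injective {a} {x} {y} a≤n e = begin
    x                            ≡⟨ shift-inverseˡ x a≤n ⟨
    shift (n ∸ a) (shift a x)    ≡⟨ cong (shift (n ∸ a)) e ⟩
    shift (n ∸ a) (shift a y)    ≡⟨ shift-inverseˡ y a≤n ⟩
    y                            ∎

  toℕ-shift-from : ∀ a x → toℕ (shift (n ∸ toℕ x + a) x) ≡ a % n
  toℕ-shift-from a x = begin
    toℕ (shift (n ∸ toℕ x + a) x)  ≡⟨ toℕ-shift _ x ⟩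
    (toℕ x + (n ∸ toℕ x + a)) % n  ≡⟨ cong (_% n) (+-assoc (toℕ x) (n ∸ toℕ x) a) ⟨
    (toℕ x + (n ∸ toℕ x) + a) % n  ≡⟨ cong (λ z → (z + a) % n) (m+[n∸m]≡n (<⇒≤ (toℕ<n x))) ⟩
    (n + a) % n                    ≡⟨ cong (_% n) (+-comm n a) ⟩
    (a + n) % n                    ≡⟨ [m+n]%n≡m%n a n ⟩
    a % n                          ∎

  shift-onto : ∀ x y → shift (n ∸ toℕ x + toℕ y) x ≡ y
  shift-onto x y = toℕ-injective (trans (toℕ-shift-from (toℕ y) x) (m<n⇒m%n≡m (toℕ<n y)))

  shift-cancelʳ : ∀ {a b} x → shift a x ≡ shift b x → a % n ≡ b % n
  shift-cancelʳ {a} {b} x e = begin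
    a % n                          ≡⟨ toℕ-shift-from a x ⟨
    toℕ (shift (n ∸ toℕ x + a) x)  ≡⟨ cong toℕ (shift-+ (n ∸ toℕ x) a x) ⟨
    toℕ (shift (n ∸ toℕ x) (shift a x))  ≡⟨ cong (λ z → toℕ (shift (n ∸ toℕ x) z)) e ⟩
    toℕ (shift (n ∸ toℕ x) (shift b x))  ≡⟨ cong toℕ (shift-+ (n ∸ toℕ x) b x) ⟩
    toℕ (shift (n ∸ toℕ x + b) x)  ≡⟨ toℕ-shift-from b x ⟩
    b % n                          ∎

  shift-cancelʳ-< : ∀ {a b} x → a < n → b < n → shift a x ≡ shift b x → a ≡ b
  shift-cancelʳ-< x a<n b<n e =
    trans (sym (m<n⇒m%n≡m a<n)) (trans (shift-cancelʳ x e) (m<n⇒m%n≡m b<n))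

  iter-shift : ∀ j x → iter (shift 1) j x ≡ shift j x
  iter-shift zero    x = sym (shift-0 x)
  iter-shift (suc j) x = trans (cong (shift 1) (iter-shift j x)) (shift-+ 1 j x)

does⇒witness : ∀ {a} {A : Set a} (a? : Dec A) → does a? ≡ true → A
does⇒witness (yes a) _ = a

count-cong : ∀ {n} {f g : Fin n → Bool} → (∀ i → f i ≡ g i) → count f ≡ count g
count-cong {zero}  _   = refl
count-cong {suc n} f≗g = cong₂ (λ b c → (if b then 1 else 0) + c) (f≗g zero) (count-cong (λ i → f≗g (suc i)))

count-false : ∀ {n} {f : Fin n → Bool} → (∀ i → f i ≡ false) → count f ≡ 0
count-false {zero}      _ = refl
count-false {suc n} {f} f≗false rewrite f≗false zero = count-false (λ i → f≗false (suc i))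

count-∨ : ∀ {n} (f g : Fin n → Bool) → (∀ i → f i ≡ true → g i ≡ false) →
          count (λ i → f i ∨ g i) ≡ count f + count g
count-∨ {zero}  f g disjoint = refl
count-∨ {suc n} f g disjoint
  with f zero in f₀ | g zero in g₀ | count-∨ (λ i → f (suc i)) (λ i → g (suc i)) (λ i → disjoint (suc i))
... | true  | true  | _    = contradiction (trans (sym g₀) (disjoint zero f₀)) λ ()
... | true  | false | tail = cong suc tail
... | false | true  | tail = trans (cong suc tail) (sym (+-suc (count (λ i → f (suc i))) _))
... | false | false | tail = tail

count-singleton : ∀ {n} (a : Fin n) → count (λ p → does (p ≟ a)) ≡ 1
count-singleton {suc n} zero    = cong suc (count-false {n} (λ _ → refl))
count-singleton {suc n} (suc a) = count-singleton a

inImage : ∀ {m n} → (Fin m → Fin n) → Fin n → Bool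
inImage f p = does (any? λ i → p ≟ f i)

count-image : ∀ {m n} (f : Fin m → Fin n) → Injective _≡_ _≡_ f → count (inImage f) ≡ m
count-image {zero}  f _   = count-false {f = inImage f} (λ _ → refl)
count-image {suc m} f inj = begin
  count (λ p → does (p ≟ f zero) ∨ inImage (λ i → f (suc i)) p)
    ≡⟨ count-∨ (λ p → does (p ≟ f zero)) (inImage (λ i → f (suc i))) disjoint ⟩
  count (λ p → does (p ≟ f zero)) + count (inImage (λ i → f (suc i)))
    ≡⟨ cong₂ _+_ (count-singleton (f zero)) (count-image (λ i → f (suc i)) (λ e → suc-injective (inj e))) ⟩
  suc m ∎
  where
    open ≡-Reasoning
    disjoint : ∀ p → does (p ≟ f zero) ≡ true → inImage (λ i → f (suc i)) p ≡ false
    disjoint p p≡f₀ = dec-false (any? λ i → p ≟ f (suc i)) λ { (i , p≡fᵢ) →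
      contradiction (inj (trans (sym (does⇒witness (p ≟ f zero) p≡f₀)) p≡fᵢ)) λ () }

offset : Fin 3 → ℕ
offset zero             = 0
offset (suc zero)       = 1
offset (suc (suc zero)) = 3

δ₀ δ₁ δ₃ : Fin 3
δ₀ = zero
δ₁ = suc zero
δ₃ = suc (suc zero)

offset≤3 : ∀ i → offset i ≤ 3
offset≤3 zero             = z≤n
offset≤3 (suc zero)       = s≤s z≤n
offset≤3 (suc (suc zero)) = s≤s (s≤s (s≤s z≤n))

sidon : ∀ i j k l → offset i + offset l ≡ offset j + offset k → i ≢ j → i ≡ k
sidon = toWitness {a? = all? λ i → all? λ j → all? λ k → all? λ l →
          (offset i + offset l ≟ℕ offset j + offset k) →-dec ¬? (i ≟ j) →-dec (i ≟ k)} tt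

offset-injective : Injective _≡_ _≡_ offset
offset-injective {i} {j} e with i ≟ j
... | yes i≡j = i≡j
... | no  i≢j = sidon i j j i (cong₂ _+_ e e) i≢j

module _ {n : ℕ} {C : Config n} {S : Vertex n → Bool} where

  _++_ : ∀ {u v w} → Reach C S u v → Reach C S v w → Reach C S u w
  here          ++ r = r
  step a v∉S r₁ ++ r = step a v∉S (r₁ ++ r)

adj-irrefl : ∀ {n} (C : Config n) {u} → ¬ Adj C u u
adj-irrefl C {inj₁ _} ()
adj-irrefl C {inj₂ _} ()

adj⇒adj² : ∀ {n} (C : Config n) {u v} → Adj C u v → Adj² C u v
adj⇒adj² C a = (λ { refl → adj-irrefl C a }) , inj₁ a

avoid : ∀ {n} {C : Config n} {S u v} → IndependentInSquare C S → S u ≡ true → Adj² C u v → S v ≡ false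
avoid {S = S} {u} {v} ind u∈S a with S v in v∈S
... | true  = ⊥-elim (ind u v u∈S v∈S a)
... | false = refl

unsplittable-by-detours : ∀ {n} (C : Config n) (next : Vertex n → Vertex n) →
  (∀ w → Adj C w (next w)) →
  (∀ u v → ∃ λ j → iter next j u ≡ v) →
  (∀ S → IndependentInSquare C S → ∀ w → S w ≡ false → S (next w) ≡ true → Reach C S w (next (next w))) →
  Unsplittable C
unsplittable-by-detours C next adj tour detour (S , ind , u , v , u∉S , v∉S , ¬reach) with tour u v
... | j , refl = ¬reach (proj₁ (progress j) v∉S)
  where
    x : ℕ → Vertex _
    x j = iter next j u

    Progress : ℕ → Set
    Progress j = (S (x j) ≡ false → Reach C S u (x j)) × (S (x j) ≡ true → Reach C S u (x (suc j)))

    progress : ∀ j → Progress j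
    progress zero = (λ _ → here) , (λ u∈S → contradiction (trans (sym u∉S) u∈S) λ ())
    progress (suc j) with progress j
    ... | reached , jumped with S (x j) in xⱼ | S (x (suc j)) in xⱼ₊₁
    ...   | false | false = (λ _ → reached refl ++ step (adj (x j)) xⱼ₊₁ here) , λ ()
    ...   | false | true  = (λ ()) , λ _ → reached refl ++ detour S ind (x j) xⱼ xⱼ₊₁
    ...   | true  | false = (λ _ → jumped refl) , λ ()
    ...   | true  | true  = ⊥-elim (ind _ _ xⱼ xⱼ₊₁ (adj⇒adj² C (adj (x j))))

iter-pull : ∀ {A : Set} (f : A → A) j x → iter f j (f x) ≡ iter f (suc j) x
iter-pull f zero    x = refl
iter-pull f (suc j) x = cong f (iter-pull f j x)

module Cyclic013 (k : ℕ) where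
  n : ℕ
  n = 7 + k

  open Rotation n

  small : ∀ {a} → a ≤ 6 → a < n
  small a≤6 = ≤-trans (s≤s a≤6) (m≤m+n 7 k)

  offset+offset≤6 : ∀ i j → offset i + offset j ≤ 6
  offset+offset≤6 i j = +-mono-≤ (offset≤3 i) (offset≤3 j)

  offset<n : ∀ i → offset i < n
  offset<n i = small (≤-trans (offset≤3 i) (s≤s (s≤s (s≤s z≤n))))

  offset≤n : ∀ i → offset i ≤ n
  offset≤n i = <⇒≤ (offset<n i)

  incidence : Fin n → Fin n → Bool
  incidence p l = inImage (λ i → shift (offset i) l) p

  incident : ∀ i l → incidence (shift (offset i) l) l ≡ true
  incident i l = dec-true (any? λ j → shift (offset i) l ≟ shift (offset j) l) (i , refl)

  incidence⇒offset : ∀ {p l} → incidence p l ≡ true → ∃ λ i → p ≡ shift (offset i) l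
  incidence⇒offset {p} {l} = does⇒witness (any? λ i → p ≟ shift (offset i) l)

  three-points : ∀ l → count (λ p → incidence p l) ≡ 3
  three-points l = count-image (λ i → shift (offset i) l)
    (λ {i} {j} e → offset-injective (shift-cancelʳ-< l (offset<n i) (offset<n j) e))

  -- p ∈ l + D  ⇔  l ∈ p − D, so each point lies on three lines
  three-lines : ∀ p → count (λ l → incidence p l) ≡ 3
  three-lines p = trans (count-cong {f = λ l → incidence p l} {g = inImage back} λ l →
      does-⇔ (mk⇔ (to l) (from l)) (any? λ i → p ≟ shift (offset i) l) (any? λ i → l ≟ back i)) (count-image back back-injective)
    where
      back : Fin 3 → Fin n
      back i = shift (n ∸ offset i) p
      to : ∀ l → (∃ λ i → p ≡ shift (offset i) l) → ∃ λ i → l ≡ back i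
      to l (i , refl) = i , sym (shift-inverseˡ l (offset≤n i))
      from : ∀ l → (∃ λ i → l ≡ back i) → ∃ λ i → p ≡ shift (offset i) l
      from l (i , refl) = i , sym (shift-inverseʳ p (offset≤n i))
      -- rotating back i by either offset returns p
      back-injective : Injective _≡_ _≡_ back
      back-injective {i} {j} e = offset-injective (shift-cancelʳ-< (back i) (offset<n i) (offset<n j)
        (trans (shift-inverseʳ p (offset≤n i)) (trans (sym (shift-inverseʳ p (offset≤n j))) (cong (shift (offset j)) (sym e)))))

  unique-line : ∀ p q l m → p ≢ q → incidence p l ≡ true → incidence q l ≡ true →
                incidence p m ≡ true → incidence q m ≡ true → l ≡ m
  unique-line p q l m p≢q pl ql pm qm
    with incidence⇒offset {p} {l} pl | incidence⇒offset {q} {l} ql | incidence⇒offset {p} {m} pm | incidence⇒offset {q} {m} qm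
  ... | i , refl | j , q≡ | i′ , p≡ | j′ , refl =
    shift-injective (offset≤n i) (trans p≡ (cong (λ c → shift (offset c) m) (sym i≡i′)))
    where
      open ≡-Reasoning
      -- (l + dᵢ) + dⱼ′ and (l + dⱼ) + dᵢ′ both equal m + dᵢ′ + dⱼ′
      sums : shift (offset i + offset j′) l ≡ shift (offset j + offset i′) l
      sums = begin
        shift (offset i + offset j′) l              ≡⟨ cong (λ c → shift c l) (+-comm (offset i) (offset j′)) ⟩
        shift (offset j′ + offset i) l              ≡⟨ shift-+ (offset j′) (offset i) l ⟨
        shift (offset j′) (shift (offset i) l)      ≡⟨ cong (shift (offset j′)) p≡ ⟩
        shift (offset j′) (shift (offset i′) m)     ≡⟨ shift-comm (offset j′) (offset i′) m ⟩
        shift (offset i′) (shift (offset j′) m)     ≡⟨ cong (shift (offset i′)) q≡ ⟩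
        shift (offset i′) (shift (offset j) l)      ≡⟨ shift-+ (offset i′) (offset j) l ⟩
        shift (offset i′ + offset j) l              ≡⟨ cong (λ c → shift c l) (+-comm (offset i′) (offset j)) ⟩
        shift (offset j + offset i′) l              ∎
      i≡i′ : i ≡ i′
      i≡i′ = sidon i j i′ j′
        (shift-cancelʳ-< l (small (offset+offset≤6 i j′)) (small (offset+offset≤6 j i′)) sums)
        (λ { refl → p≢q (sym q≡) })

  C : Config n
  C = record { inc = incidence ; line3 = three-points ; point3 = three-lines ; atMostOne = unique-line }

  rotate-bijective : Bijective _≡_ _≡_ (shift 1)
  rotate-bijective = shift-injective (s≤s z≤n) ,
    λ y → shift (n ∸ 1) y , λ { refl → shift-inverseʳ y (s≤s z≤n) }

  rotate-preserves : ∀ p l → incidence (shift 1 p) (shift 1 l) ≡ incidence p l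
  rotate-preserves p l = does-⇔ (mk⇔ to from)
    (any? λ i → shift 1 p ≟ shift (offset i) (shift 1 l)) (any? λ i → p ≟ shift (offset i) l)
    where
      to : (∃ λ i → shift 1 p ≡ shift (offset i) (shift 1 l)) → ∃ λ i → p ≡ shift (offset i) l
      to (i , e) = i , shift-injective (s≤s z≤n) (trans e (shift-comm (offset i) 1 l))
      from : (∃ λ i → p ≡ shift (offset i) l) → ∃ λ i → shift 1 p ≡ shift (offset i) (shift 1 l)
      from (i , refl) = i , shift-comm 1 (offset i) l

  rotate-cycle : ∀ p → ∃ λ j → iter (shift 1) j zero ≡ p
  rotate-cycle p = n + toℕ p , trans (iter-shift (n + toℕ p) zero) (shift-onto zero p)

  cyclic : Cyclic C
  cyclic = record
    { σ = shift 1 ; τ = shift 1 ; σ-bij = rotate-bijective ; τ-bij = rotate-bijective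
    ; pres = rotate-preserves ; p₀ = zero ; l₀ = zero
    ; σ-cycle = rotate-cycle ; τ-cycle = rotate-cycle }

  next : Vertex n → Vertex n
  next (inj₁ p) = inj₂ p
  next (inj₂ l) = inj₁ (shift 1 l)

  next-adj : ∀ w → Adj C w (next w)
  next-adj (inj₁ p) = subst (λ x → incidence x p ≡ true) (shift-0 p) (incident δ₀ p)
  next-adj (inj₂ l) = incident δ₁ l

  next-twice : ∀ j p → iter next (j + j) (inj₁ p) ≡ inj₁ (shift j p)
  next-twice zero    p = cong inj₁ (sym (shift-0 p))
  next-twice (suc j) p rewrite +-suc j j =
    trans (cong (λ w → next (next w)) (next-twice j p)) (cong inj₁ (shift-+ 1 j p))

  from-point : ∀ p v → ∃ λ j → iter next j (inj₁ p) ≡ v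
  from-point p (inj₁ q) = j + j , trans (next-twice j p) (cong inj₁ (shift-onto p q))
    where j = n ∸ toℕ p + toℕ q
  from-point p (inj₂ q) = suc (j + j) , cong next (trans (next-twice j p) (cong inj₁ (shift-onto p q)))
    where j = n ∸ toℕ p + toℕ q

  tour : ∀ u v → ∃ λ j → iter next j u ≡ v
  tour (inj₁ p) v = from-point p v
  tour (inj₂ l) v with from-point (shift 1 l) v
  ... | j , e = suc j , trans (sym (iter-pull next j (inj₂ l))) e

  module Detours (S : Vertex n → Bool) (ind : IndependentInSquare C S) where

    module Window (c : Fin n) where
      P L : ℕ → Vertex n
      P i = inj₁ (shift i c)
      L i = inj₂ (shift i c)

      on : ∀ d i → Adj C (P (offset d + i)) (L i)
      on d i = subst (λ x → incidence x (shift i c) ≡ true) (shift-+ (offset d) i c) (incident d (shift i c))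

      label-distinct : ∀ i j {_ : True (i <? 7)} {_ : True (j <? 7)} {_ : False (i ≟ℕ j)} → shift i c ≢ shift j c
      label-distinct i j {i<7} {j<7} {i≢j} e = toWitnessFalse i≢j
        (shift-cancelʳ-< c (≤-trans (toWitness i<7) (m≤m+n 7 k)) (≤-trans (toWitness j<7) (m≤m+n 7 k)) e)

      collinear : ∀ {i j m} → shift i c ≢ shift j c → Adj C (P i) (L m) → Adj C (L m) (P j) → Adj² C (P i) (P j)
      collinear {m = m} i≢j a b = (λ e → i≢j (inj₁-injective e)) , inj₂ (L m , a , b)

      concurrent : ∀ {i j m} → shift i c ≢ shift j c → Adj C (L i) (P m) → Adj C (P m) (L j) → Adj² C (L i) (L j)
      concurrent {m = m} i≢j a b = (λ e → i≢j (inj₂-injective e)) , inj₂ (P m , a , b)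

      -- P2 ∉ S, L2 ∈ S: walk to P3 via L1 and either P4, L3 or P1, L0
      around-line : S (P 2) ≡ false → S (L 2) ≡ true → Reach C S (P 2) (P 3)
      around-line _ L2∈S with S (P 4) in P4
      ... | false = step (on δ₁ 1) L1∉S (step (on δ₃ 1) P4 (step (on δ₁ 3) L3∉S (step (on δ₀ 3) P3∉S here)))
        where
          L1∉S = avoid ind L2∈S (concurrent (label-distinct 2 1) (on δ₀ 2) (on δ₁ 1))
          L3∉S = avoid ind L2∈S (concurrent (label-distinct 2 3) (on δ₁ 2) (on δ₀ 3))
          P3∉S = avoid ind L2∈S (adj⇒adj² C (on δ₁ 2))
      ... | true = step (on δ₁ 1) L1∉S (step (on δ₀ 1) P1∉S (step (on δ₁ 0) L0∉S (step (on δ₃ 0) P3∉S here)))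
        where
          L1∉S = avoid ind L2∈S (concurrent (label-distinct 2 1) (on δ₀ 2) (on δ₁ 1))
          P1∉S = avoid ind P4 (collinear (label-distinct 4 1) (on δ₃ 1) (on δ₀ 1))
          L0∉S = avoid ind L2∈S (concurrent (label-distinct 2 0) (on δ₁ 2) (on δ₃ 0))
          P3∉S = avoid ind L2∈S (adj⇒adj² C (on δ₁ 2))

      -- L1 ∉ S, P2 ∈ S: walk to L2 via P3 and either P1, L0 or P4, L3
      around-point : S (L 1) ≡ false → S (P 2) ≡ true → Reach C S (L 1) (L 2)
      around-point _ P2∈S with S (L 0) in L0
      ... | false = step (on δ₀ 1) P1∉S (step (on δ₁ 0) L0 (step (on δ₃ 0) P3∉S (step (on δ₁ 2) L2∉S here)))
        where
          P1∉S = avoid ind P2∈S (collinear (label-distinct 2 1) (on δ₁ 1) (on δ₀ 1))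
          P3∉S = avoid ind P2∈S (collinear (label-distinct 2 3) (on δ₀ 2) (on δ₁ 2))
          L2∉S = avoid ind P2∈S (adj⇒adj² C (on δ₀ 2))
      ... | true = step (on δ₃ 1) P4∉S (step (on δ₁ 3) L3∉S (step (on δ₀ 3) P3∉S (step (on δ₁ 2) L2∉S here)))
        where
          P4∉S = avoid ind P2∈S (collinear (label-distinct 2 4) (on δ₁ 1) (on δ₃ 1))
          L3∉S = avoid ind L0 (concurrent (label-distinct 0 3) (on δ₃ 0) (on δ₀ 3))
          P3∉S = avoid ind P2∈S (collinear (label-distinct 2 3) (on δ₀ 2) (on δ₁ 2))
          L2∉S = avoid ind P2∈S (adj⇒adj² C (on δ₀ 2))

    -- place the window so that w sits at label 2 (a point) or 1 (a line)
    detour : ∀ w → S w ≡ false → S (next w) ≡ true → Reach C S w (next (next w))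
    detour (inj₁ p) = subst (λ x → S (inj₁ x) ≡ false → S (inj₂ x) ≡ true → Reach C S (inj₁ x) (inj₁ (shift 1 x)))
      (shift-inverseʳ p (s≤s (s≤s z≤n)))
      (λ w∉S w⁺∈S → subst (Reach C S _) (cong inj₁ (sym (shift-+ 1 2 c))) (around-line w∉S w⁺∈S))
      where
        c = shift (n ∸ 2) p
        open Window c
    detour (inj₂ l) = subst (λ x → S (inj₂ x) ≡ false → S (inj₁ (shift 1 x)) ≡ true → Reach C S (inj₂ x) (inj₂ (shift 1 x)))
      (shift-inverseʳ l (s≤s z≤n))
      (λ w∉S w⁺∈S → subst (Reach C S _) (cong inj₂ (sym (shift-+ 1 1 c)))
        (around-point w∉S (subst (λ x → S (inj₁ x) ≡ true) (shift-+ 1 1 c) w⁺∈S)))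
      where
        c = shift (n ∸ 1) l
        open Window c

  unsplittable : Unsplittable C
  unsplittable = unsplittable-by-detours C next next-adj tour (λ S ind → Detours.detour S ind)

theorem9 : ∀ (m : ℕ) → ∃ λ (n : ℕ) → m ≤ n × Σ (Config n) (λ C → Cyclic C × Unsplittable C)
theorem9 m = 7 + m , m≤n+m m 7 , C , cyclic , unsplittable
  where open Cyclic013 m
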